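{- For all positive integers $n$ and $k$ and all non-negative integers $i,j,\ell$, $\mathcal{C}(n;k;i,j,\ell)=\mathcal{P}(n;k;i,j,\ell)$, where $\mathcal{C}(n;k;i,j,\ell)$ is the number of pairs $(\lambda,\mu)$ with $\lambda\in\mathcal{C}$ and $\mu$ an unrestricted ordinary partition all of whose parts are coloured $c$, of total weight $|\lambda|+|\mu|=n$, having in total (in $\lambda$ and $\mu$ together) $i$ parts coloured $a$, $j$ parts coloured $c$, $\ell$ parts coloured $d$, and all parts of value at most $k$; and $\mathcal{P}(n;k;i,j,\ell)$ is the number of $\lambda\in\mathcal{P}$ of weight $n$ having $i$ parts coloured $a$, $j$ parts coloured $b$ or $c$, $\ell$ parts coloured $d$, and all parts of value at most $k$.
   Context: A coloured integer is a positive integer $m$ with a colour, written $m_x$; its value is $m$, and the weight of a partition is the sum of the values of its parts. $\mathcal{C}$: colours $a,c,d$, total order $1_a<1_c<1_d<2_a<2_c<2_d<3_a<\cdots$. A partition in $\mathcal{C}$ is a finite sequence $\lambda_1\ge\cdots\ge\lambda_s$ (in this order, possibly empty) such that consecutive parts $\lambda_i=m_x,\lambda_{i+1}=m'_y$ satisfy $m-m'\ge C(x,y)$ with $C(a,a)=C(a,c)=C(a,d)=2$; $C(c,a)=1,C(c,c)=1,C(c,d)=2$; $C(d,a)=0,C(d,c)=1,C(d,d)=2$. $\mathcal{P}$: colours $a,b,c,d$, total order $1_a<1_b<1_c<1_d<2_a<2_b<\cdots$. A partition in $\mathcal{P}$ is a finite non-increasing (in this order) sequence with consecutive parts $m_x,m'_y$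 satisfying $m-m'\ge P(x,y)$ with $P(a,a)=2,P(a,b)=1,P(a,c)=2,P(a,d)=2$; $P(b,a)=1,P(b,b)=0,P(b,c)=1,P(b,d)=1$; $P(c,a)=0,P(c,b)=1,P(c,c)=0,P(c,d)=2$; $P(d,a)=0,P(d,b)=1,P(d,c)=0,P(d,d)=2$. -}

module Defs where

open import Data.Nat using (ℕ; zero; suc; _+_; _≤_)
open import Data.Product using (Σ; _×_; _,_; proj₁; proj₂)
open import Data.List using (List; []; _∷_; map; length)
open import Data.Nat.ListAction using (sum)
open import Data.List.Relation.Unary.All using (All)
open import Relation.Binary.PropositionalEquality using (_≡_)
open import Data.Bool using (Bool; true; false; if_then_else_)

data ColC : Set where
  a c d : ColC

data ColP : Set where
  a b c d : ColP

Cdiff : ColC → ColC → ℕ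
Cdiff a a = 2
Cdiff a c = 2
Cdiff a d = 2
Cdiff c a = 1
Cdiff c c = 1
Cdiff c d = 2
Cdiff d a = 0
Cdiff d c = 1
Cdiff d d = 2

Pdiff : ColP → ColP → ℕ
Pdiff a a = 2
Pdiff a b = 1
Pdiff a c = 2
Pdiff a d = 2
Pdiff b a = 1
Pdiff b b = 0
Pdiff b c = 1
Pdiff b d = 1
Pdiff c a = 0
Pdiff c b = 1
Pdiff c c = 0
Pdiff c d = 2
Pdiff d a = 0
Pdiff d b = 1
Pdiff d c = 0
Pdiff d d = 2

-- A coloured part is (value , colour); a partition is the list of its parts
-- λ₁, λ₂, …, λ_s in this order.  Consecutive parts m_x, m'_y must satisfy
-- m - m' ≥ D(x,y), i.e. m' + D(x,y) ≤ m.

data Chain {Col : Set} (D : Col → Col → ℕ) : List (ℕ × Col) → Set where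
  []  : Chain D []
  [_] : ∀ p → Chain D (p ∷ [])
  _∷_ : ∀ {m x m' y ps} → m' + D x y ≤ m →
        Chain D ((m' , y) ∷ ps) → Chain D ((m , x) ∷ (m' , y) ∷ ps)

Positive : {Col : Set} → List (ℕ × Col) → Set
Positive ps = All (λ p → 1 ≤ proj₁ p) ps

IsCPartition : List (ℕ × ColC) → Set
IsCPartition ps = Positive ps × Chain Cdiff ps

IsPPartition : List (ℕ × ColP) → Set
IsPPartition ps = Positive ps × Chain Pdiff ps

data NonIncr : List ℕ → Set where
  []  : NonIncr []
  [_] : ∀ m → NonIncr (m ∷ [])
  _∷_ : ∀ {m m' ms} → m' ≤ m → NonIncr (m' ∷ ms) → NonIncr (m ∷ m' ∷ ms)

IsOrdPartition : List ℕ → Set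
IsOrdPartition ms = All (λ m → 1 ≤ m) ms × NonIncr ms

weight : {Col : Set} → List (ℕ × Col) → ℕ
weight ps = sum (map proj₁ ps)

isA-C isC-C isD-C : ColC → Bool
isA-C a = true
isA-C _ = false
isC-C c = true
isC-C _ = false
isD-C d = true
isD-C _ = false

isA-P isBC-P isD-P : ColP → Bool
isA-P a = true
isA-P _ = false
isBC-P b = true
isBC-P c = true
isBC-P _ = false
isD-P d = true
isD-P _ = false

countCol : {Col : Set} → (Col → Bool) → List (ℕ × Col) → ℕ
countCol P [] = 0
countCol P ((_ , x) ∷ ps) = if P x then suc (countCol P ps) else countCol P ps

-- The objects counted by 𝒞(n;k;i,j,ℓ): pairs (λ , μ), λ ∈ 𝒞, μ an ordinary
-- partition with all parts coloured c.

record CObj (n k i j ℓ : ℕ) : Set where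
  constructor cobj
  field
    lam      : List (ℕ × ColC)
    mu       : List ℕ
    lamC     : IsCPartition lam
    muOrd    : IsOrdPartition mu
    wt       : weight lam + sum mu ≡ n
    numA     : countCol isA-C lam ≡ i
    numC     : countCol isC-C lam + length mu ≡ j
    numD     : countCol isD-C lam ≡ ℓ
    lamBound : All (λ p → proj₁ p ≤ k) lam
    muBound  : All (λ m → m ≤ k) mu

record PObj (n k i j ℓ : ℕ) : Set where
  constructor pobj
  field
    lam      : List (ℕ × ColP)
    lamP     : IsPPartition lam
    wt       : weight lam ≡ n
    numA     : countCol isA-P lam ≡ i
    numBC    : countCol isBC-P lam ≡ j
    numD     : countCol isD-P lam ≡ ℓ
    lamBound : All (λ p → proj₁ p ≤ k) lam

-- The bijection merges λ and μ into one non-increasing sequence. Parts of λ keep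
-- their colour; a part n of μ is coloured c if λ has a part of value n and b
-- otherwise, and on a tie it is placed before n_a or n_c but after n_d. The inverse
-- splits a 𝒫-partition: a- and d-parts go to λ, b-parts to μ, and a c-part goes to
-- μ exactly when it repeats the value of the preceding λ-part or of the next part.
-- The difference conditions of 𝒞 are just strong enough for the merge to satisfy
-- those of 𝒫. Conversely, Pdiff satisfies the triangle inequality, so in a
-- 𝒫-partition the condition holds between any two parts, not only neighbours, and
-- this survives deleting the parts that go to μ. Weights and the counts of a, b or
-- c, and d are preserved since b and c are counted together.
module Submission where

open import Function.Bundles using (_↔_; mk↔ₛ′)
open import Data.Bool using (Bool; true; false; if_then_else_)
open import Data.Empty using (⊥; ⊥-elim)
open import Data.Unit using (⊤; tt)
open import Data.Nat using (ℕ; suc; _+_; _≤_; _<_; _≤?_; z≤n; s≤s)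
open import Data.Nat.Properties
open import Algebra.Properties.CommutativeSemigroup +-commutativeSemigroup using (x∙yz≈y∙xz)
open import Data.Nat.ListAction using (sum)
open import Data.Product using (Σ-syntax; _×_; _,_; proj₁; proj₂)
open import Data.Sum using (_⊎_; inj₁; inj₂)
open import Data.List using (List; []; _∷_; length; map)
open import Data.List.Relation.Unary.All using (All; []; _∷_)
import Data.List.Relation.Unary.All as All
open import Data.List.Relation.Unary.Any using (here; there)
open import Data.List.Membership.Propositional using (_∈_)
open import Relation.Binary.Definitions using (Tri; tri<; tri≈; tri>)
open import Relation.Binary.PropositionalEquality
open import Relation.Nullary using (Dec; yes; no; ¬_)
open import Relation.Nullary.Decidable using (from-yes)

open import Defs

embed : ColC → ColP
embed a = a
embed c = c
embed d = d

embed≢b : ∀ x → embed x ≢ b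
embed≢b a ()
embed≢b c ()
embed≢b d ()

Pdiff-embed-≤ : ∀ x y → Pdiff (embed x) (embed y) ≤ Cdiff x y
Pdiff-embed-≤ a a = ≤-refl
Pdiff-embed-≤ a c = ≤-refl
Pdiff-embed-≤ a d = ≤-refl
Pdiff-embed-≤ c a = z≤n
Pdiff-embed-≤ c c = z≤n
Pdiff-embed-≤ c d = ≤-refl
Pdiff-embed-≤ d a = z≤n
Pdiff-embed-≤ d c = z≤n
Pdiff-embed-≤ d d = ≤-refl

Pdiff-triangle : ∀ x y z → Pdiff x z ≤ Pdiff x y + Pdiff y z
Pdiff-triangle x y z =
  All.lookup (All.lookup (All.lookup table (∈-colours x)) (∈-colours y)) (∈-colours z)
  where
  colours : List ColP
  colours = a ∷ b ∷ c ∷ d ∷ []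
  ∈-colours : ∀ x → x ∈ colours
  ∈-colours a = here refl
  ∈-colours b = there (here refl)
  ∈-colours c = there (there (here refl))
  ∈-colours d = there (there (there (here refl)))
  table : All (λ x → All (λ y → All (λ z → Pdiff x z ≤ Pdiff x y + Pdiff y z) colours) colours) colours
  table = from-yes (All.all? (λ x → All.all? (λ y → All.all? (λ z →
            Pdiff x z ≤? Pdiff x y + Pdiff y z) colours) colours) colours)

Cdiff-to-c-pos : ∀ x → 1 ≤ Cdiff x c
Cdiff-to-c-pos a = s≤s z≤n
Cdiff-to-c-pos c = s≤s z≤n
Cdiff-to-c-pos d = s≤s z≤n

Cdiff-from-c-pos : ∀ y → 1 ≤ Cdiff c y
Cdiff-from-c-pos a = s≤s z≤n
Cdiff-from-c-pos c = s≤s z≤n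
Cdiff-from-c-pos d = s≤s z≤n

Pdiff-from-a-pos : ∀ y → 1 ≤ Pdiff a y
Pdiff-from-a-pos a = s≤s z≤n
Pdiff-from-a-pos b = s≤s z≤n
Pdiff-from-a-pos c = s≤s z≤n
Pdiff-from-a-pos d = s≤s z≤n

Pdiff-to-b-pos : ∀ x → x ≢ b → 1 ≤ Pdiff x b
Pdiff-to-b-pos a _ = s≤s z≤n
Pdiff-to-b-pos b x≢b = ⊥-elim (x≢b refl)
Pdiff-to-b-pos c _ = s≤s z≤n
Pdiff-to-b-pos d _ = s≤s z≤n

Pdiff-from-b-pos : ∀ y → y ≢ b → 1 ≤ Pdiff b y
Pdiff-from-b-pos a _ = s≤s z≤n
Pdiff-from-b-pos b y≢b = ⊥-elim (y≢b refl)
Pdiff-from-b-pos c _ = s≤s z≤n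
Pdiff-from-b-pos d _ = s≤s z≤n

Pdiff-embed-to-b-≤1 : ∀ x → Pdiff (embed x) b ≤ 1
Pdiff-embed-to-b-≤1 a = ≤-refl
Pdiff-embed-to-b-≤1 c = ≤-refl
Pdiff-embed-to-b-≤1 d = ≤-refl

+-pos⇒< : ∀ {v k m} → 1 ≤ k → v + k ≤ m → v < m
+-pos⇒< {v} 0<k h = <-≤-trans (m<m+n v 0<k) h

<⇒+1≤ : ∀ {v m} → v < m → v + 1 ≤ m
<⇒+1≤ {v} {m} h = subst (_≤ m) (+-comm 1 v) h

≤⇒+0≤ : ∀ {v m} → v ≤ m → v + 0 ≤ m
≤⇒+0≤ {v} {m} h = subst (_≤ m) (sym (+-identityʳ v)) h

<⇒+≤1≤ : ∀ {v m k} → v < m → k ≤ 1 → v + k ≤ m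
<⇒+≤1≤ {v} lt k≤1 = ≤-trans (+-monoʳ-≤ v k≤1) (<⇒+1≤ lt)

OnHead : {A : Set} → (A → Set) → List A → Set
OnHead P [] = ⊤
OnHead P (x ∷ _) = P x

OnHead-map : {A : Set} {P Q : A → Set} (xs : List A) → (∀ x → P x → Q x) → OnHead P xs → OnHead Q xs
OnHead-map [] f h = tt
OnHead-map (x ∷ _) f h = f x h

All⇒OnHead : {A : Set} {P : A → Set} {xs : List A} → All P xs → OnHead P xs
All⇒OnHead [] = tt
All⇒OnHead (p ∷ _) = p

MayFollow : {Col : Set} → (Col → Col → ℕ) → ℕ → Col → ℕ × Col → Set
MayFollow D m x q = proj₁ q + D x (proj₂ q) ≤ m

module _ {Col : Set} {D : Col → Col → ℕ} where

  chain-head : ∀ {m x l} → Chain D ((m , x) ∷ l) → OnHead (MayFollow D m x) l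
  chain-head [ _ ] = tt
  chain-head (h ∷ _) = h

  chain-tail : ∀ {q l} → Chain D (q ∷ l) → Chain D l
  chain-tail [ _ ] = []
  chain-tail (_ ∷ ch) = ch

  chain-cons : ∀ {m x l} → OnHead (MayFollow D m x) l → Chain D l → Chain D ((m , x) ∷ l)
  chain-cons {m} {x} {[]} _ _ = [ (m , x) ]
  chain-cons {l = _ ∷ _} h ch = h ∷ ch

  chain-sorted : ∀ {q l} → Chain D (q ∷ l) → All (λ q′ → proj₁ q′ ≤ proj₁ q) l
  chain-sorted [ _ ] = []
  chain-sorted (_∷_ {m} {x} {m′} {y} h ch) =
    m′≤m ∷ All.map (λ le → ≤-trans le m′≤m) (chain-sorted ch)
    where
    m′≤m : m′ ≤ m
    m′≤m = ≤-trans (m≤m+n m′ (D x y)) h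

  chain-irrelevant : ∀ {l} (p q : Chain D l) → p ≡ q
  chain-irrelevant [] [] = refl
  chain-irrelevant [ _ ] [ _ ] = refl
  chain-irrelevant (h ∷ p) (h′ ∷ q) = cong₂ _∷_ (≤-irrelevant h h′) (chain-irrelevant p q)

nonIncr-head : ∀ {n μ} → NonIncr (n ∷ μ) → OnHead (_≤ n) μ
nonIncr-head [ _ ] = tt
nonIncr-head (h ∷ _) = h

nonIncr-tail : ∀ {n μ} → NonIncr (n ∷ μ) → NonIncr μ
nonIncr-tail [ _ ] = []
nonIncr-tail (_ ∷ ni) = ni

nonIncr-cons : ∀ {n μ} → OnHead (_≤ n) μ → NonIncr μ → NonIncr (n ∷ μ)
nonIncr-cons {n} {[]} _ _ = [ n ]
nonIncr-cons {μ = _ ∷ _} h ni = h ∷ ni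

nonIncr-irrelevant : ∀ {μ} (p q : NonIncr μ) → p ≡ q
nonIncr-irrelevant [] [] = refl
nonIncr-irrelevant [ _ ] [ _ ] = refl
nonIncr-irrelevant (h ∷ p) (h′ ∷ q) = cong₂ _∷_ (≤-irrelevant h h′) (nonIncr-irrelevant p q)

Pchain⇒All-MayFollow : ∀ {m x l} → Chain Pdiff ((m , x) ∷ l) → All (MayFollow Pdiff m x) l
Pchain⇒All-MayFollow [ _ ] = []
Pchain⇒All-MayFollow (_∷_ {m} {x} {m′} {y} h ch) = h ∷ All.map (λ {q} → step q) (Pchain⇒All-MayFollow ch)
  where
  step : ∀ q → MayFollow Pdiff m′ y q → MayFollow Pdiff m x q
  step (v , z) le = begin
    v + Pdiff x z                 ≤⟨ +-monoʳ-≤ v (Pdiff-triangle x y z) ⟩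
    v + (Pdiff x y + Pdiff y z)   ≡⟨ cong (v +_) (+-comm (Pdiff x y) (Pdiff y z)) ⟩
    v + (Pdiff y z + Pdiff x y)   ≡⟨ sym (+-assoc v (Pdiff y z) (Pdiff x y)) ⟩
    (v + Pdiff y z) + Pdiff x y   ≤⟨ +-monoˡ-≤ (Pdiff x y) le ⟩
    m′ + Pdiff x y                ≤⟨ h ⟩
    m                             ∎
    where open ≤-Reasoning

-- In the merge, s is the value of the part of λ emitted last (0 before any).
ordinaryColour : ℕ → ℕ → ColP
ordinaryColour s n with n ≟ s
... | yes _ = c
... | no _ = b

ordinaryColour-≡ : ∀ {s n} → n ≡ s → ordinaryColour s n ≡ c
ordinaryColour-≡ {s} {n} n≡s with n ≟ s
... | yes _ = refl
... | no n≢s = ⊥-elim (n≢s n≡s)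

ordinaryColour-≢ : ∀ {s n} → n ≢ s → ordinaryColour s n ≡ b
ordinaryColour-≢ {s} {n} n≢s with n ≟ s
... | yes n≡s = ⊥-elim (n≢s n≡s)
... | no _ = refl

mergeStep : (s m : ℕ) (x : ColC) (n : ℕ) → Tri (m < n) (m ≡ n) (n < m) →
            List (ℕ × ColP) → List (ℕ × ColP) → List (ℕ × ColP)
mergeStep s m x n (tri< _ _ _) μ-first λ-first = (n , ordinaryColour s n) ∷ μ-first
mergeStep s m a n (tri≈ _ _ _) μ-first λ-first = (n , c) ∷ μ-first
mergeStep s m c n (tri≈ _ _ _) μ-first λ-first = (n , c) ∷ μ-first
mergeStep s m d n (tri≈ _ _ _) μ-first λ-first = (m , d) ∷ λ-first
mergeStep s m x n (tri> _ _ _) μ-first λ-first = (m , embed x) ∷ λ-first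

merge : ℕ → List (ℕ × ColC) → List ℕ → List (ℕ × ColP)
merge s [] [] = []
merge s [] (n ∷ μ) = (n , ordinaryColour s n) ∷ merge s [] μ
merge s ((m , x) ∷ l) [] = (m , embed x) ∷ merge m l []
merge s ((m , x) ∷ l) (n ∷ μ) =
  mergeStep s m x n (<-cmp m n) (merge s ((m , x) ∷ l) μ) (merge m l (n ∷ μ))

HeadValue : ℕ → List (ℕ × ColP) → Set
HeadValue m [] = ⊥
HeadValue m ((v , _) ∷ _) = v ≡ m

headValue? : ∀ m ps → Dec (HeadValue m ps)
headValue? m [] = no (λ ())
headValue? m ((v , _) ∷ _) = v ≟ m

Split : Set
Split = List (ℕ × ColC) × List ℕ

consλ : ℕ × ColC → Split → Split
consλ q (l , μ) = (q ∷ l , μ)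

consμ : ℕ → Split → Split
consμ n (l , μ) = (l , n ∷ μ)

split : ℕ → List (ℕ × ColP) → Split
split s [] = ([] , [])
split s ((m , a) ∷ ps) = consλ (m , a) (split m ps)
split s ((m , b) ∷ ps) = consμ m (split s ps)
split s ((m , c) ∷ ps) with m ≟ s | headValue? m ps
... | yes _ | _ = consμ m (split s ps)
... | no _ | yes _ = consμ m (split s ps)
... | no _ | no _ = consλ (m , c) (split m ps)
split s ((m , d) ∷ ps) = consλ (m , d) (split m ps)

-- Weights, colour counts and bounds

All-merge : ∀ (Q : ℕ → Set) s l μ → All (λ q → Q (proj₁ q)) l → All Q μ →
            All (λ q → Q (proj₁ q)) (merge s l μ)
All-merge Q s [] [] _ _ = []
All-merge Q s [] (n ∷ μ) [] (q ∷ qs) = q ∷ All-merge Q s [] μ [] qs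
All-merge Q s ((m , x) ∷ l) [] (p ∷ ps) [] = p ∷ All-merge Q m l [] ps []
All-merge Q s ((m , x) ∷ l) (n ∷ μ) (p ∷ ps) (q ∷ qs) =
  step x (<-cmp m n) (All-merge Q s ((m , x) ∷ l) μ (p ∷ ps) qs) (All-merge Q m l (n ∷ μ) ps (q ∷ qs))
  where
  step : ∀ x t {r₁ r₂} → All (λ q → Q (proj₁ q)) r₁ → All (λ q → Q (proj₁ q)) r₂ →
         All (λ q → Q (proj₁ q)) (mergeStep s m x n t r₁ r₂)
  step x (tri< _ _ _) h₁ h₂ = q ∷ h₁
  step a (tri≈ _ _ _) h₁ h₂ = q ∷ h₁
  step c (tri≈ _ _ _) h₁ h₂ = q ∷ h₁
  step d (tri≈ _ _ _) h₁ h₂ = p ∷ h₂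
  step x (tri> _ _ _) h₁ h₂ = p ∷ h₂

All-splitλ : ∀ (Q : ℕ × ColP → Set) s ps → All Q ps →
             All (λ q → Q (proj₁ q , embed (proj₂ q))) (proj₁ (split s ps))
All-splitλ Q s [] [] = []
All-splitλ Q s ((m , a) ∷ ps) (q ∷ qs) = q ∷ All-splitλ Q m ps qs
All-splitλ Q s ((m , b) ∷ ps) (q ∷ qs) = All-splitλ Q s ps qs
All-splitλ Q s ((m , c) ∷ ps) (q ∷ qs) with m ≟ s | headValue? m ps
... | yes _ | _ = All-splitλ Q s ps qs
... | no _ | yes _ = All-splitλ Q s ps qs
... | no _ | no _ = q ∷ All-splitλ Q m ps qs
All-splitλ Q s ((m , d) ∷ ps) (q ∷ qs) = q ∷ All-splitλ Q m ps qs

All-splitμ : ∀ (Q : ℕ → Set) s ps → All (λ q → Q (proj₁ q)) ps → All Q (proj₂ (split s ps))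
All-splitμ Q s [] [] = []
All-splitμ Q s ((m , a) ∷ ps) (q ∷ qs) = All-splitμ Q m ps qs
All-splitμ Q s ((m , b) ∷ ps) (q ∷ qs) = q ∷ All-splitμ Q s ps qs
All-splitμ Q s ((m , c) ∷ ps) (q ∷ qs) with m ≟ s | headValue? m ps
... | yes _ | _ = q ∷ All-splitμ Q s ps qs
... | no _ | yes _ = q ∷ All-splitμ Q s ps qs
... | no _ | no _ = All-splitμ Q m ps qs
All-splitμ Q s ((m , d) ∷ ps) (q ∷ qs) = All-splitμ Q m ps qs

weight-merge : ∀ s l μ → weight (merge s l μ) ≡ weight l + sum μ
weight-merge s [] [] = refl
weight-merge s [] (n ∷ μ) = cong (n +_) (weight-merge s [] μ)
weight-merge s ((m , x) ∷ l) [] = trans (cong (m +_) (weight-merge m l [])) (sym (+-assoc m (weight l) 0))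
weight-merge s ((m , x) ∷ l) (n ∷ μ) =
  step x (<-cmp m n) (weight-merge s ((m , x) ∷ l) μ) (weight-merge m l (n ∷ μ))
  where
  W S : ℕ
  W = weight l
  S = sum μ
  μ-first : ∀ {w} → w ≡ (m + W) + S → n + w ≡ (m + W) + (n + S)
  μ-first h = trans (cong (n +_) h) (x∙yz≈y∙xz n (m + W) S)
  λ-first : ∀ {w} → w ≡ W + (n + S) → m + w ≡ (m + W) + (n + S)
  λ-first h = trans (cong (m +_) h) (sym (+-assoc m W (n + S)))
  step : ∀ x t {r₁ r₂} → weight r₁ ≡ (m + W) + S → weight r₂ ≡ W + (n + S) →
         weight (mergeStep s m x n t r₁ r₂) ≡ (m + W) + (n + S)
  step x (tri< _ _ _) h₁ h₂ = μ-first h₁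
  step a (tri≈ _ _ _) h₁ h₂ = μ-first h₁
  step c (tri≈ _ _ _) h₁ h₂ = μ-first h₁
  step d (tri≈ _ _ _) h₁ h₂ = λ-first h₂
  step x (tri> _ _ _) h₁ h₂ = λ-first h₂

bump : Bool → ℕ → ℕ
bump β n = if β then suc n else n

bump-+ˡ : ∀ β m n → bump β (m + n) ≡ bump β m + n
bump-+ˡ true m n = refl
bump-+ˡ false m n = refl

bump-+ʳ : ∀ β m n → bump β (m + n) ≡ m + bump β n
bump-+ʳ true m n = sym (+-suc m n)
bump-+ʳ false m n = refl

countCol-ofColour : ∀ {Col : Set} (Q : Col → Bool) y μ →
                    countCol Q (map (λ n → n , y) μ) ≡ (if Q y then length μ else 0)
countCol-ofColour Q y [] with Q y
... | true = refl
... | false = refl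
countCol-ofColour Q y (n ∷ μ) with Q y | countCol-ofColour Q y μ
... | true | ih = cong suc ih
... | false | ih = ih

ordinaryColour-count : ∀ (Q : ColP → Bool) → Q b ≡ Q c → ∀ s n → Q (ordinaryColour s n) ≡ Q c
ordinaryColour-count Q Qb≡Qc s n with n ≟ s
... | yes _ = refl
... | no _ = Qb≡Qc

count-merge : ∀ (Q : ColP → Bool) (Q′ : ColC → Bool) → (∀ x → Q (embed x) ≡ Q′ x) → Q b ≡ Q c →
              ∀ s l μ → countCol Q (merge s l μ) ≡ countCol Q′ l + countCol Q (map (λ n → n , c) μ)
count-merge Q Q′ Q∘embed Qb≡Qc = go
  where
  ordinary : ∀ s n k → countCol Q ((n , ordinaryColour s n) ∷ k) ≡ bump (Q c) (countCol Q k)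
  ordinary s n k rewrite ordinaryColour-count Q Qb≡Qc s n = refl
  λ-part : ∀ m x k → countCol Q ((m , embed x) ∷ k) ≡ bump (Q′ x) (countCol Q k)
  λ-part m x k rewrite Q∘embed x = refl
  go : ∀ s l μ → countCol Q (merge s l μ) ≡ countCol Q′ l + countCol Q (map (λ n → n , c) μ)
  go s [] [] = refl
  go s [] (n ∷ μ) = trans (ordinary s n (merge s [] μ)) (cong (bump (Q c)) (go s [] μ))
  go s ((m , x) ∷ l) [] =
    trans (λ-part m x (merge m l [])) (trans (cong (bump (Q′ x)) (go m l [])) (bump-+ˡ (Q′ x) _ 0))
  go s ((m , x) ∷ l) (n ∷ μ) = step x (<-cmp m n) (go s ((m , x) ∷ l) μ) (go m l (n ∷ μ))
    where
    M : ℕ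
    M = countCol Q (map (λ n → n , c) μ)
    μ-first : ∀ {w L} → w ≡ L + M → bump (Q c) w ≡ L + bump (Q c) M
    μ-first {L = L} h = trans (cong (bump (Q c)) h) (bump-+ʳ (Q c) L M)
    λ-first : ∀ x {w} → w ≡ countCol Q′ l + bump (Q c) M →
              bump (Q′ x) w ≡ bump (Q′ x) (countCol Q′ l) + bump (Q c) M
    λ-first x h = trans (cong (bump (Q′ x)) h) (bump-+ˡ (Q′ x) _ _)
    step : ∀ x t {r₁ r₂} → countCol Q r₁ ≡ countCol Q′ ((m , x) ∷ l) + M →
           countCol Q r₂ ≡ countCol Q′ l + bump (Q c) M →
           countCol Q (mergeStep s m x n t r₁ r₂) ≡ countCol Q′ ((m , x) ∷ l) + bump (Q c) M
    step x (tri< _ _ _) {r₁} h₁ h₂ = trans (ordinary s n r₁) (μ-first h₁)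
    step a (tri≈ _ _ _) h₁ h₂ = μ-first h₁
    step c (tri≈ _ _ _) h₁ h₂ = μ-first h₁
    step d (tri≈ _ _ _) {r₂ = r₂} h₁ h₂ = trans (λ-part m d r₂) (λ-first d h₂)
    step x (tri> _ _ _) {r₂ = r₂} h₁ h₂ = trans (λ-part m x r₂) (λ-first x h₂)

count-merge-a : ∀ s l μ → countCol isA-P (merge s l μ) ≡ countCol isA-C l
count-merge-a s l μ =
  trans (count-merge isA-P isA-C (λ { a → refl ; c → refl ; d → refl }) refl s l μ)
        (trans (cong (countCol isA-C l +_) (countCol-ofColour isA-P c μ)) (+-identityʳ _))

count-merge-d : ∀ s l μ → countCol isD-P (merge s l μ) ≡ countCol isD-C l
count-merge-d s l μ =
  trans (count-merge isD-P isD-C (λ { a → refl ; c → refl ; d → refl }) refl s l μ)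
        (trans (cong (countCol isD-C l +_) (countCol-ofColour isD-P c μ)) (+-identityʳ _))

count-merge-bc : ∀ s l μ → countCol isBC-P (merge s l μ) ≡ countCol isC-C l + length μ
count-merge-bc s l μ =
  trans (count-merge isBC-P isC-C (λ { a → refl ; c → refl ; d → refl }) refl s l μ)
        (cong (countCol isC-C l +_) (countCol-ofColour isBC-P c μ))

-- Splitting a merge

CHeadAvoids : ℕ → List (ℕ × ColC) → Set
CHeadAvoids s [] = ⊤
CHeadAvoids s ((m , x) ∷ _) = x ≡ c → m ≢ s

Cchain⇒CHeadAvoids : ∀ {m x l} → Chain Cdiff ((m , x) ∷ l) → CHeadAvoids m l
Cchain⇒CHeadAvoids {l = []} ch = tt
Cchain⇒CHeadAvoids {x = x} {l = (m′ , y) ∷ l} ch refl = <⇒≢ (+-pos⇒< (Cdiff-to-c-pos x) (chain-head ch))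

Cchain-c-head-< : ∀ {m l} → Chain Cdiff ((m , c) ∷ l) → OnHead (λ q → proj₁ q < m) l
Cchain-c-head-< {l = []} ch = tt
Cchain-c-head-< {l = (m′ , y) ∷ l} ch = +-pos⇒< (Cdiff-from-c-pos y) (chain-head ch)

merge-head-< : ∀ s l μ m → OnHead (λ q → proj₁ q < m) l → OnHead (_< m) μ → ¬ HeadValue m (merge s l μ)
merge-head-< s [] [] m h₁ h₂ ()
merge-head-< s [] (n ∷ μ) m h₁ h₂ e = <⇒≢ h₂ e
merge-head-< s ((m′ , x) ∷ l) [] m h₁ h₂ e = <⇒≢ h₁ e
merge-head-< s ((m′ , x) ∷ l) (n ∷ μ) m h₁ h₂ = step x (<-cmp m′ n)
  where
  step : ∀ x t → ¬ HeadValue m (mergeStep s m′ x n t (merge s ((m′ , x) ∷ l) μ) (merge m′ l (n ∷ μ)))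
  step x (tri< _ _ _) e = <⇒≢ h₂ e
  step a (tri≈ _ _ _) e = <⇒≢ h₂ e
  step c (tri≈ _ _ _) e = <⇒≢ h₂ e
  step d (tri≈ _ _ _) e = <⇒≢ h₁ e
  step x (tri> _ _ _) e = <⇒≢ h₁ e

merge-head-≡ : ∀ s m x l μ → OnHead (_≤ m) μ → HeadValue m (merge s ((m , x) ∷ l) μ)
merge-head-≡ s m x l [] h = refl
merge-head-≡ s m x l (n ∷ μ) h = step x (<-cmp m n)
  where
  step : ∀ x t → HeadValue m (mergeStep s m x n t (merge s ((m , x) ∷ l) μ) (merge m l (n ∷ μ)))
  step x (tri< lt _ _) = ⊥-elim (<⇒≱ lt h)
  step a (tri≈ _ e _) = sym e
  step c (tri≈ _ e _) = sym e
  step d (tri≈ _ e _) = refl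
  step x (tri> _ _ _) = refl

split-c-to-μ : ∀ s n r → n ≡ s ⊎ HeadValue n r → split s ((n , c) ∷ r) ≡ consμ n (split s r)
split-c-to-μ s n r h with n ≟ s | headValue? n r
... | yes _ | _ = refl
... | no _ | yes _ = refl
split-c-to-μ s n r (inj₁ n≡s) | no n≢s | no _ = ⊥-elim (n≢s n≡s)
split-c-to-μ s n r (inj₂ hv) | no _ | no ¬hv = ⊥-elim (¬hv hv)

split-c-to-λ : ∀ s n r → n ≢ s → ¬ HeadValue n r → split s ((n , c) ∷ r) ≡ consλ (n , c) (split n r)
split-c-to-λ s n r n≢s ¬hv with n ≟ s | headValue? n r
... | yes n≡s | _ = ⊥-elim (n≢s n≡s)
... | no _ | yes hv = ⊥-elim (¬hv hv)
... | no _ | no _ = refl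

split-ordinary : ∀ s n r → split s ((n , ordinaryColour s n) ∷ r) ≡ consμ n (split s r)
split-ordinary s n r with n ≟ s
... | yes n≡s = split-c-to-μ s n r (inj₁ n≡s)
... | no _ = refl

split-merge : ∀ s l μ → Chain Cdiff l → NonIncr μ → CHeadAvoids s l → split s (merge s l μ) ≡ (l , μ)
split-merge s [] [] _ _ _ = refl
split-merge s [] (n ∷ μ) ch ni _ =
  trans (split-ordinary s n (merge s [] μ)) (cong (consμ n) (split-merge s [] μ ch (nonIncr-tail ni) tt))
split-merge s ((m , a) ∷ l) [] ch _ _ =
  cong (consλ (m , a)) (split-merge m l [] (chain-tail ch) [] (Cchain⇒CHeadAvoids ch))
split-merge s ((m , d) ∷ l) [] ch _ _ =
  cong (consλ (m , d)) (split-merge m l [] (chain-tail ch) [] (Cchain⇒CHeadAvoids ch))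
split-merge s ((m , c) ∷ l) [] ch _ av =
  trans (split-c-to-λ s m (merge m l []) (av refl) (merge-head-< m l [] m (Cchain-c-head-< ch) tt))
        (cong (consλ (m , c)) (split-merge m l [] (chain-tail ch) [] (Cchain⇒CHeadAvoids ch)))
split-merge s ((m , x) ∷ l) (n ∷ μ) ch ni av =
  step x (<-cmp m n) ch av (split-merge s ((m , x) ∷ l) μ ch (nonIncr-tail ni) av)
       (split-merge m l (n ∷ μ) (chain-tail ch) ni (Cchain⇒CHeadAvoids ch))
  where
  tie : ∀ x → m ≡ n → HeadValue n (merge s ((m , x) ∷ l) μ)
  tie x refl = merge-head-≡ s m x l μ (nonIncr-head ni)
  step : ∀ x t → Chain Cdiff ((m , x) ∷ l) → CHeadAvoids s ((m , x) ∷ l) →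
         split s (merge s ((m , x) ∷ l) μ) ≡ ((m , x) ∷ l , μ) →
         split m (merge m l (n ∷ μ)) ≡ (l , n ∷ μ) →
         split s (mergeStep s m x n t (merge s ((m , x) ∷ l) μ) (merge m l (n ∷ μ))) ≡ ((m , x) ∷ l , n ∷ μ)
  step x (tri< _ _ _) ch av h₁ h₂ = trans (split-ordinary s n _) (cong (consμ n) h₁)
  step a (tri≈ _ e _) ch av h₁ h₂ = trans (split-c-to-μ s n _ (inj₂ (tie a e))) (cong (consμ n) h₁)
  step c (tri≈ _ e _) ch av h₁ h₂ = trans (split-c-to-μ s n _ (inj₂ (tie c e))) (cong (consμ n) h₁)
  step d (tri≈ _ _ _) ch av h₁ h₂ = cong (consλ (m , d)) h₂
  step a (tri> _ _ _) ch av h₁ h₂ = cong (consλ (m , a)) h₂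
  step d (tri> _ _ _) ch av h₁ h₂ = cong (consλ (m , d)) h₂
  step c (tri> _ _ n<m) ch av h₁ h₂ =
    trans (split-c-to-λ s m _ (av refl) (merge-head-< m l (n ∷ μ) m (Cchain-c-head-< ch) n<m))
          (cong (consλ (m , c)) h₂)

-- Merging a split

merge-λ-first : ∀ s m x l μ → All (_< m) μ → merge s ((m , x) ∷ l) μ ≡ (m , embed x) ∷ merge m l μ
merge-λ-first s m x l [] _ = refl
merge-λ-first s m x l (n ∷ μ) (n<m ∷ _) = step x (<-cmp m n)
  where
  step : ∀ x t → mergeStep s m x n t (merge s ((m , x) ∷ l) μ) (merge m l (n ∷ μ)) ≡
                 (m , embed x) ∷ merge m l (n ∷ μ)
  step x (tri< m<n _ _) = ⊥-elim (<-asym m<n n<m)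
  step a (tri≈ _ m≡n _) = ⊥-elim (<⇒≢ n<m (sym m≡n))
  step c (tri≈ _ m≡n _) = ⊥-elim (<⇒≢ n<m (sym m≡n))
  step d (tri≈ _ _ _) = refl
  step a (tri> _ _ _) = refl
  step c (tri> _ _ _) = refl
  step d (tri> _ _ _) = refl

merge-d-first : ∀ s m l μ → All (_≤ m) μ → merge s ((m , d) ∷ l) μ ≡ (m , d) ∷ merge m l μ
merge-d-first s m l [] _ = refl
merge-d-first s m l (n ∷ μ) (n≤m ∷ _) with <-cmp m n
... | tri< m<n _ _ = ⊥-elim (<⇒≱ m<n n≤m)
... | tri≈ _ _ _ = refl
... | tri> _ _ _ = refl

merge-μ-first : ∀ s l n μ → All (λ q → proj₁ q < n) l →
                merge s l (n ∷ μ) ≡ (n , ordinaryColour s n) ∷ merge s l μ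
merge-μ-first s [] n μ _ = refl
merge-μ-first s ((m , x) ∷ l) n μ (m<n ∷ _) = step x (<-cmp m n)
  where
  step : ∀ x t → mergeStep s m x n t (merge s ((m , x) ∷ l) μ) (merge m l (n ∷ μ)) ≡
                 (n , ordinaryColour s n) ∷ merge s ((m , x) ∷ l) μ
  step x (tri< _ _ _) = refl
  step x (tri≈ _ m≡n _) = ⊥-elim (<⇒≢ m<n m≡n)
  step x (tri> _ _ n<m) = ⊥-elim (<-asym m<n n<m)

merge-c-at-last : ∀ s l m μ → m ≡ s → OnHead (λ q → proj₁ q ≤ m × (proj₁ q ≡ m → proj₂ q ≢ d)) l →
                  merge s l (m ∷ μ) ≡ (m , c) ∷ merge s l μ
merge-c-at-last s [] m μ m≡s _ = cong (λ y → (m , y) ∷ merge s [] μ) (ordinaryColour-≡ m≡s)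
merge-c-at-last s ((m′ , x) ∷ l) m μ m≡s (m′≤m , ¬d) = step x (<-cmp m′ m) ¬d
  where
  step : ∀ x t → (m′ ≡ m → x ≢ d) →
         mergeStep s m′ x m t (merge s ((m′ , x) ∷ l) μ) (merge m′ l (m ∷ μ)) ≡ (m , c) ∷ merge s ((m′ , x) ∷ l) μ
  step x (tri< _ _ _) _ = cong (λ y → (m , y) ∷ merge s ((m′ , x) ∷ l) μ) (ordinaryColour-≡ m≡s)
  step a (tri≈ _ _ _) _ = refl
  step c (tri≈ _ _ _) _ = refl
  step d (tri≈ _ m′≡m _) ¬d = ⊥-elim (¬d m′≡m refl)
  step x (tri> _ _ m<m′) _ = ⊥-elim (<⇒≱ m<m′ m′≤m)

merge-c-at-tie : ∀ s m x l μ → x ≢ d → merge s ((m , x) ∷ l) (m ∷ μ) ≡ (m , c) ∷ merge s ((m , x) ∷ l) μ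
merge-c-at-tie s m x l μ = step x (<-cmp m m)
  where
  step : ∀ x t → x ≢ d → mergeStep s m x m t (merge s ((m , x) ∷ l) μ) (merge m l (m ∷ μ)) ≡
                         (m , c) ∷ merge s ((m , x) ∷ l) μ
  step x (tri< m<m _ _) _ = ⊥-elim (<-irrefl refl m<m)
  step a (tri≈ _ _ _) _ = refl
  step c (tri≈ _ _ _) _ = refl
  step d (tri≈ _ _ _) x≢d = ⊥-elim (x≢d refl)
  step x (tri> _ _ m<m) _ = ⊥-elim (<-irrefl refl m<m)

-- A run of equal c-parts ends in a part m_a or in a c-part that goes to λ.
split-λ-head-at : ∀ s m ps → m ≢ s → HeadValue m ps → Chain Pdiff ((m , c) ∷ ps) →
                  Σ[ x ∈ ColC ] Σ[ l ∈ List (ℕ × ColC) ] proj₁ (split s ps) ≡ (m , x) ∷ l × x ≢ d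
split-λ-head-at s m ((v , a) ∷ ps) m≢s refl ch = a , _ , refl , (λ ())
split-λ-head-at s m ((v , b) ∷ ps) m≢s refl ch = ⊥-elim (<-irrefl refl (+-pos⇒< (s≤s z≤n) (chain-head ch)))
split-λ-head-at s m ((v , d) ∷ ps) m≢s refl ch = ⊥-elim (<-irrefl refl (+-pos⇒< (s≤s z≤n) (chain-head ch)))
split-λ-head-at s m ((v , c) ∷ ps) m≢s refl ch with v ≟ s | headValue? v ps
... | yes v≡s | _ = ⊥-elim (m≢s v≡s)
... | no _ | yes hv = split-λ-head-at s v ps m≢s hv (chain-tail ch)
... | no _ | no _ = c , _ , refl , (λ ())

BPartsAvoid : ℕ → List (ℕ × ColP) → Set
BPartsAvoid s = All (λ q → proj₂ q ≡ b → proj₁ q ≢ s)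

Pchain⇒BPartsAvoid : ∀ {m x ps} → x ≢ b → Chain Pdiff ((m , x) ∷ ps) → BPartsAvoid m ps
Pchain⇒BPartsAvoid {x = x} x≢b ch =
  All.map (λ le y≡b → <⇒≢ (+-pos⇒< (subst (λ y → 1 ≤ Pdiff x y) (sym y≡b) (Pdiff-to-b-pos x x≢b)) le))
          (Pchain⇒All-MayFollow ch)

Pchain-below : ∀ m ps → ¬ HeadValue m ps → All (λ q → proj₁ q ≤ m) ps → Chain Pdiff ps →
               All (λ q → proj₁ q < m) ps
Pchain-below m [] _ _ _ = []
Pchain-below m ((v , y) ∷ ps) v≢m (v≤m ∷ _) ch = v<m ∷ All.map (λ h → ≤-<-trans h v<m) (chain-sorted ch)
  where
  v<m : v < m
  v<m = ≤∧≢⇒< v≤m v≢m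

merge-split-c-at-last : ∀ s m ps → Chain Pdiff ((m , c) ∷ ps) → m ≡ s →
                        merge s (proj₁ (split s ps)) (proj₂ (split s ps)) ≡ ps →
                        merge s (proj₁ (split s ps)) (m ∷ proj₂ (split s ps)) ≡ (m , c) ∷ ps
merge-split-c-at-last s m ps ch m≡s ih =
  trans (merge-c-at-last s (proj₁ (split s ps)) m (proj₂ (split s ps)) m≡s
                         (All⇒OnHead (All.map below-¬d (All-splitλ Q s ps qs))))
        (cong ((m , c) ∷_) ih)
  where
  Q : ℕ × ColP → Set
  Q q = proj₁ q ≤ m × (proj₁ q ≡ m → proj₂ q ≢ d)
  qs : All Q ps
  qs = All.map (λ {(v , y)} le → ≤-trans (m≤m+n v _) le ,
                                 λ { v≡m refl → <-irrefl v≡m (+-pos⇒< (s≤s z≤n) le) })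
               (Pchain⇒All-MayFollow ch)
  below-¬d : ∀ {q} → Q (proj₁ q , embed (proj₂ q)) → proj₁ q ≤ m × (proj₁ q ≡ m → proj₂ q ≢ d)
  below-¬d (le , ¬d) = le , λ v≡m x≡d → ¬d v≡m (cong embed x≡d)

merge-split : ∀ s ps → Chain Pdiff ps → BPartsAvoid s ps → merge s (proj₁ (split s ps)) (proj₂ (split s ps)) ≡ ps
merge-split s [] _ _ = refl
merge-split s ((m , a) ∷ ps) ch _ =
  trans (merge-λ-first s m a _ _ (All-splitμ (_< m) m ps
           (All.map (λ {q} le → +-pos⇒< (Pdiff-from-a-pos (proj₂ q)) le) (Pchain⇒All-MayFollow ch))))
        (cong ((m , a) ∷_) (merge-split m ps (chain-tail ch) (Pchain⇒BPartsAvoid (λ ()) ch)))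
merge-split s ((m , d) ∷ ps) ch _ =
  trans (merge-d-first s m _ _ (All-splitμ (_≤ m) m ps (chain-sorted ch)))
        (cong ((m , d) ∷_) (merge-split m ps (chain-tail ch) (Pchain⇒BPartsAvoid (λ ()) ch)))
merge-split s ((m , b) ∷ ps) ch (m≢s ∷ av) =
  trans (merge-μ-first s _ m _ λ-below)
        (cong₂ (λ y r → (m , y) ∷ r) (ordinaryColour-≢ (m≢s refl)) (merge-split s ps (chain-tail ch) av))
  where
  below-unless-b : All (λ q → proj₂ q ≢ b → proj₁ q < m) ps
  below-unless-b = All.map (λ {q} le y≢b → +-pos⇒< (Pdiff-from-b-pos (proj₂ q) y≢b) le) (Pchain⇒All-MayFollow ch)
  λ-below : All (λ q → proj₁ q < m) (proj₁ (split s ps))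
  λ-below = All.map (λ {q} h → h (embed≢b (proj₂ q))) (All-splitλ _ s ps below-unless-b)
merge-split s ((m , c) ∷ ps) ch av with m ≟ s | headValue? m ps
merge-split s ((m , c) ∷ ps) ch (_ ∷ av) | yes m≡s | _ =
  merge-split-c-at-last s m ps ch m≡s (merge-split s ps (chain-tail ch) av)
merge-split s ((m , c) ∷ ps) ch (_ ∷ av) | no m≢s | yes hv with split-λ-head-at s m ps m≢s hv ch
... | x , l , λ≡ , x≢d =
  trans (subst (λ L → merge s L (m ∷ proj₂ (split s ps)) ≡ (m , c) ∷ merge s L (proj₂ (split s ps))) (sym λ≡)
               (merge-c-at-tie s m x l (proj₂ (split s ps)) x≢d))
        (cong ((m , c) ∷_) (merge-split s ps (chain-tail ch) av))
merge-split s ((m , c) ∷ ps) ch _ | no _ | no ¬hv =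
  trans (merge-λ-first s m c _ _ (All-splitμ (_< m) m ps below))
        (cong ((m , c) ∷_) (merge-split m ps (chain-tail ch) (All.map (λ lt _ → <⇒≢ lt) below)))
  where
  below : All (λ q → proj₁ q < m) ps
  below = Pchain-below m ps ¬hv (chain-sorted ch) (chain-tail ch)

-- The split lands in 𝒞 × ordinary partitions

CPartsAvoid : ℕ → List (ℕ × ColC) → Set
CPartsAvoid s = All (λ q → proj₂ q ≡ c → proj₁ q ≢ s)

CPartsAvoid-raise : ∀ {m s l} → m ≤ s → All (λ q → proj₁ q ≤ m) l → CPartsAvoid m l → CPartsAvoid s l
CPartsAvoid-raise m≤s ≤m av =
  All.zipWith (λ { (v≤m , ≢m) y≡c v≡s → ≢m y≡c (≤-antisym v≤m (subst (_ ≤_) (sym v≡s) m≤s)) }) (≤m , av)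

-- The parts of λ are at most s, and a c-part of value s would have gone to μ.
split-CPartsAvoid : ∀ s ps → All (λ q → proj₁ q ≤ s) ps → Chain Pdiff ps → CPartsAvoid s (proj₁ (split s ps))
split-CPartsAvoid s [] _ _ = []
split-CPartsAvoid s ((m , a) ∷ ps) (m≤s ∷ _) ch =
  (λ ()) ∷ CPartsAvoid-raise m≤s (All-splitλ _ m ps (chain-sorted ch))
                                   (split-CPartsAvoid m ps (chain-sorted ch) (chain-tail ch))
split-CPartsAvoid s ((m , d) ∷ ps) (m≤s ∷ _) ch =
  (λ ()) ∷ CPartsAvoid-raise m≤s (All-splitλ _ m ps (chain-sorted ch))
                                   (split-CPartsAvoid m ps (chain-sorted ch) (chain-tail ch))
split-CPartsAvoid s ((m , b) ∷ ps) (_ ∷ ≤s) ch = split-CPartsAvoid s ps ≤s (chain-tail ch)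
split-CPartsAvoid s ((m , c) ∷ ps) (m≤s ∷ ≤s) ch with m ≟ s | headValue? m ps
... | yes _ | _ = split-CPartsAvoid s ps ≤s (chain-tail ch)
... | no _ | yes _ = split-CPartsAvoid s ps ≤s (chain-tail ch)
... | no m≢s | no _ =
  (λ _ → m≢s) ∷ CPartsAvoid-raise m≤s (All-splitλ _ m ps (chain-sorted ch))
                                   (split-CPartsAvoid m ps (chain-sorted ch) (chain-tail ch))

Pfollow⇒Cfollow-a : ∀ v m y → v + Pdiff a (embed y) ≤ m → v + Cdiff a y ≤ m
Pfollow⇒Cfollow-a v m a h = h
Pfollow⇒Cfollow-a v m c h = h
Pfollow⇒Cfollow-a v m d h = h

Pfollow⇒Cfollow-d : ∀ v m y → v + Pdiff d (embed y) ≤ m → (y ≡ c → v ≢ m) → v ≤ m → v + Cdiff d y ≤ m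
Pfollow⇒Cfollow-d v m a h _ _ = h
Pfollow⇒Cfollow-d v m c h v≢m v≤m = <⇒+1≤ (≤∧≢⇒< v≤m (v≢m refl))
Pfollow⇒Cfollow-d v m d h _ _ = h

Pfollow⇒Cfollow-c : ∀ v m y → v + Pdiff c (embed y) ≤ m → v < m → v + Cdiff c y ≤ m
Pfollow⇒Cfollow-c v m a h v<m = <⇒+1≤ v<m
Pfollow⇒Cfollow-c v m c h v<m = <⇒+1≤ v<m
Pfollow⇒Cfollow-c v m d h v<m = h

split-λ-chain : ∀ s ps → Chain Pdiff ps → Chain Cdiff (proj₁ (split s ps))
split-λ-chain s [] _ = []
split-λ-chain s ((m , a) ∷ ps) ch =
  chain-cons (All⇒OnHead (All.map (λ {(v , y)} h → Pfollow⇒Cfollow-a v m y h)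
                                  (All-splitλ _ m ps (Pchain⇒All-MayFollow ch))))
             (split-λ-chain m ps (chain-tail ch))
split-λ-chain s ((m , d) ∷ ps) ch =
  chain-cons (All⇒OnHead (All.zipWith (λ { {(v , y)} ((h , v≤m) , av) → Pfollow⇒Cfollow-d v m y h av v≤m })
               (All.zip (All-splitλ _ m ps (Pchain⇒All-MayFollow ch) , All-splitλ _ m ps (chain-sorted ch)) ,
                split-CPartsAvoid m ps (chain-sorted ch) (chain-tail ch))))
             (split-λ-chain m ps (chain-tail ch))
split-λ-chain s ((m , b) ∷ ps) ch = split-λ-chain s ps (chain-tail ch)
split-λ-chain s ((m , c) ∷ ps) ch with m ≟ s | headValue? m ps
... | yes _ | _ = split-λ-chain s ps (chain-tail ch)
... | no _ | yes _ = split-λ-chain s ps (chain-tail ch)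
... | no _ | no ¬hv =
  chain-cons (All⇒OnHead (All.zipWith (λ { {(v , y)} (h , v<m) → Pfollow⇒Cfollow-c v m y h v<m })
               (All-splitλ _ m ps (Pchain⇒All-MayFollow ch) ,
                All-splitλ _ m ps (Pchain-below m ps ¬hv (chain-sorted ch) (chain-tail ch)))))
             (split-λ-chain m ps (chain-tail ch))

split-μ-nonIncr : ∀ s ps → Chain Pdiff ps → NonIncr (proj₂ (split s ps))
split-μ-nonIncr s [] _ = []
split-μ-nonIncr s ((m , a) ∷ ps) ch = split-μ-nonIncr m ps (chain-tail ch)
split-μ-nonIncr s ((m , d) ∷ ps) ch = split-μ-nonIncr m ps (chain-tail ch)
split-μ-nonIncr s ((m , b) ∷ ps) ch =
  nonIncr-cons (All⇒OnHead (All-splitμ (_≤ m) s ps (chain-sorted ch))) (split-μ-nonIncr s ps (chain-tail ch))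
split-μ-nonIncr s ((m , c) ∷ ps) ch with m ≟ s | headValue? m ps
... | yes _ | _ =
  nonIncr-cons (All⇒OnHead (All-splitμ (_≤ m) s ps (chain-sorted ch))) (split-μ-nonIncr s ps (chain-tail ch))
... | no _ | yes _ =
  nonIncr-cons (All⇒OnHead (All-splitμ (_≤ m) s ps (chain-sorted ch))) (split-μ-nonIncr s ps (chain-tail ch))
... | no _ | no _ = split-μ-nonIncr m ps (chain-tail ch)

-- The merge lands in 𝒫

OnHead-merge : ∀ (R : ℕ × ColP → Set) s l μ →
               OnHead (λ q → R (proj₁ q , embed (proj₂ q))) l →
               OnHead (λ n → OnHead (λ q → proj₁ q < n) l → R (n , ordinaryColour s n)) μ →
               (∀ {m x l′ n μ′} → l ≡ (m , x) ∷ l′ → μ ≡ n ∷ μ′ → m ≡ n → R (n , c)) →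
               OnHead R (merge s l μ)
OnHead-merge R s [] [] λ-head μ-head tie = tt
OnHead-merge R s [] (n ∷ μ) λ-head μ-head tie = μ-head tt
OnHead-merge R s ((m , x) ∷ l) [] λ-head μ-head tie = λ-head
OnHead-merge R s ((m , x) ∷ l) (n ∷ μ) λ-head μ-head tie = step x (<-cmp m n) λ-head
  where
  step : ∀ x t → R (m , embed x) → OnHead R (mergeStep s m x n t (merge s ((m , x) ∷ l) μ) (merge m l (n ∷ μ)))
  step x (tri< m<n _ _) _ = μ-head m<n
  step a (tri≈ _ m≡n _) _ = tie refl refl m≡n
  step c (tri≈ _ m≡n _) _ = tie refl refl m≡n
  step d (tri≈ _ _ _) h = h
  step x (tri> _ _ _) h = h

-- The alternative s ≡ 0 covers a d-part at the very start of λ.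
DHeadGap : ℕ → List (ℕ × ColC) → Set
DHeadGap s = OnHead (λ q → proj₂ q ≡ d → s ≡ 0 ⊎ proj₁ q + 2 ≤ s)

Cchain⇒DHeadGap : ∀ {m x l} → Chain Cdiff ((m , x) ∷ l) → DHeadGap m l
Cchain⇒DHeadGap {l = []} _ = tt
Cchain⇒DHeadGap {x = a} {l = _ ∷ _} ch refl = inj₂ (chain-head ch)
Cchain⇒DHeadGap {x = c} {l = _ ∷ _} ch refl = inj₂ (chain-head ch)
Cchain⇒DHeadGap {x = d} {l = _ ∷ _} ch refl = inj₂ (chain-head ch)

Cchain⇒Pfollow : ∀ {m x l} → Chain Cdiff ((m , x) ∷ l) →
                 OnHead (λ q → proj₁ q + Pdiff (embed x) (embed (proj₂ q)) ≤ m) l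
Cchain⇒Pfollow {l = []} _ = tt
Cchain⇒Pfollow {m} {x} {(m′ , y) ∷ l} ch = ≤-trans (+-monoʳ-≤ m′ (Pdiff-embed-≤ x y)) (chain-head ch)

ordinary-follows-ordinary : ∀ s n n′ → n′ ≤ n → n′ + Pdiff (ordinaryColour s n) (ordinaryColour s n′) ≤ n
ordinary-follows-ordinary s n n′ n′≤n with n ≟ s | n′ ≟ s
... | yes _ | yes _ = ≤⇒+0≤ n′≤n
... | yes n≡s | no n′≢s = <⇒+1≤ (≤∧≢⇒< n′≤n (λ n′≡n → n′≢s (trans n′≡n n≡s)))
... | no n≢s | yes n′≡s = <⇒+1≤ (≤∧≢⇒< n′≤n (λ n′≡n → n≢s (trans (sym n′≡n) n′≡s)))
... | no _ | no _ = ≤⇒+0≤ n′≤n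

Pdiff-ordinary-to-c-≤1 : ∀ s n → Pdiff (ordinaryColour s n) c ≤ 1
Pdiff-ordinary-to-c-≤1 s n with n ≟ s
... | yes _ = z≤n
... | no _ = ≤-refl

-- If n = s then n is coloured c, and Pdiff c d = 2 is what DHeadGap provides.
λ-follows-ordinary : ∀ s n m x → 1 ≤ n → m < n → (x ≡ d → s ≡ 0 ⊎ m + 2 ≤ s) →
                     m + Pdiff (ordinaryColour s n) (embed x) ≤ n
λ-follows-ordinary s n m x 1≤n m<n gap with n ≟ s
λ-follows-ordinary s n m a 1≤n m<n gap | yes _ = ≤⇒+0≤ (<⇒≤ m<n)
λ-follows-ordinary s n m c 1≤n m<n gap | yes _ = ≤⇒+0≤ (<⇒≤ m<n)
λ-follows-ordinary s n m d 1≤n m<n gap | yes n≡s with gap refl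
... | inj₁ s≡0 = ⊥-elim (<-irrefl refl (subst (1 ≤_) (trans n≡s s≡0) 1≤n))
... | inj₂ m+2≤s = subst (m + 2 ≤_) (sym n≡s) m+2≤s
λ-follows-ordinary s n m a 1≤n m<n gap | no _ = <⇒+1≤ m<n
λ-follows-ordinary s n m c 1≤n m<n gap | no _ = <⇒+1≤ m<n
λ-follows-ordinary s n m d 1≤n m<n gap | no _ = <⇒+1≤ m<n

ordinary-follows-d : ∀ m n → n ≡ m → n + Pdiff d (ordinaryColour m n) ≤ m
ordinary-follows-d m n n≡m rewrite ordinaryColour-≡ n≡m = ≤⇒+0≤ (≤-reflexive n≡m)

ordinary-follows-λ : ∀ m n x → n < m → n + Pdiff (embed x) (ordinaryColour m n) ≤ m
ordinary-follows-λ m n x n<m rewrite ordinaryColour-≢ (<⇒≢ n<m) = <⇒+≤1≤ n<m (Pdiff-embed-to-b-≤1 x)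

tie-follows-λ : ∀ {m x m′ x′ l} n → Chain Cdiff ((m , x) ∷ (m′ , x′) ∷ l) → m′ ≡ n → n < m →
                n + Pdiff (embed x) c ≤ m
tie-follows-λ {x = a} {x′ = a} n ch refl _ = chain-head ch
tie-follows-λ {x = a} {x′ = c} n ch refl _ = chain-head ch
tie-follows-λ {x = a} {x′ = d} n ch refl _ = chain-head ch
tie-follows-λ {x = c} n ch _ n<m = ≤⇒+0≤ (<⇒≤ n<m)
tie-follows-λ {x = d} n ch _ n<m = ≤⇒+0≤ (<⇒≤ n<m)

merge-chain : ∀ s l μ → Chain Cdiff l → NonIncr μ → All (1 ≤_) μ → DHeadGap s l → Chain Pdiff (merge s l μ)
merge-chain s [] [] _ _ _ _ = []
merge-chain s [] (n ∷ μ) ch ni pos _ =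
  chain-cons (OnHead-merge _ s [] μ tt
                (OnHead-map μ (λ n′ n′≤n _ → ordinary-follows-ordinary s n n′ n′≤n) (nonIncr-head ni)) (λ ()))
             (merge-chain s [] μ [] (nonIncr-tail ni) (All.tail pos) tt)
merge-chain s ((m , x) ∷ l) [] ch ni pos _ =
  chain-cons (OnHead-merge _ m l [] (Cchain⇒Pfollow ch) tt (λ _ ()))
             (merge-chain m l [] (chain-tail ch) [] [] (Cchain⇒DHeadGap ch))
merge-chain s ((m , x) ∷ l) (n ∷ μ) ch ni pos gap =
  step x (<-cmp m n) ch gap
    (merge-chain s ((m , x) ∷ l) μ ch (nonIncr-tail ni) (All.tail pos) gap)
    (merge-chain m l (n ∷ μ) (chain-tail ch) ni pos (Cchain⇒DHeadGap ch))
  where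
  tie : ∀ x → Pdiff c (embed x) ≡ 0 → m ≡ n → Chain Pdiff (merge s ((m , x) ∷ l) μ) →
        Chain Pdiff ((n , c) ∷ merge s ((m , x) ∷ l) μ)
  tie x c→x m≡n h =
    chain-cons (OnHead-merge _ s ((m , x) ∷ l) μ (subst (λ k → m + k ≤ n) (sym c→x) (≤⇒+0≤ (≤-reflexive m≡n)))
                 (OnHead-map μ (λ n′ n′≤n m<n′ → ⊥-elim (<⇒≱ m<n′ (subst (n′ ≤_) (sym m≡n) n′≤n)))
                             (nonIncr-head ni))
                 (λ { refl refl m≡n′ → ≤⇒+0≤ (≤-reflexive (trans (sym m≡n′) m≡n)) }))
               h
  step : ∀ x t → Chain Cdiff ((m , x) ∷ l) → DHeadGap s ((m , x) ∷ l) →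
         Chain Pdiff (merge s ((m , x) ∷ l) μ) → Chain Pdiff (merge m l (n ∷ μ)) →
         Chain Pdiff (mergeStep s m x n t (merge s ((m , x) ∷ l) μ) (merge m l (n ∷ μ)))
  step x (tri< m<n _ _) ch gap h₁ h₂ =
    chain-cons (OnHead-merge _ s ((m , x) ∷ l) μ (λ-follows-ordinary s n m x (All.head pos) m<n gap)
                 (OnHead-map μ (λ n′ n′≤n _ → ordinary-follows-ordinary s n n′ n′≤n) (nonIncr-head ni))
                 (λ { refl refl refl → <⇒+≤1≤ m<n (Pdiff-ordinary-to-c-≤1 s n) }))
               h₁
  step a (tri≈ _ m≡n _) ch gap h₁ h₂ = tie a refl m≡n h₁
  step c (tri≈ _ m≡n _) ch gap h₁ h₂ = tie c refl m≡n h₁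
  step d (tri≈ _ m≡n _) ch gap h₁ h₂ =
    chain-cons (OnHead-merge _ m l (n ∷ μ) (Cchain⇒Pfollow ch) (λ _ → ordinary-follows-d m n (sym m≡n))
                 (λ { refl refl _ → ≤⇒+0≤ (≤-reflexive (sym m≡n)) }))
               h₂
  step x (tri> _ _ n<m) ch gap h₁ h₂ =
    chain-cons (OnHead-merge _ m l (n ∷ μ) (Cchain⇒Pfollow ch) (λ _ → ordinary-follows-λ m n x n<m)
                 (λ { refl refl m′≡n → tie-follows-λ n ch m′≡n n<m }))
               h₂

DHeadGap-0 : ∀ l → DHeadGap 0 l
DHeadGap-0 [] = tt
DHeadGap-0 (_ ∷ _) = λ _ → inj₁ refl

Positive⇒CHeadAvoids-0 : ∀ l → Positive l → CHeadAvoids 0 l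
Positive⇒CHeadAvoids-0 [] _ = tt
Positive⇒CHeadAvoids-0 ((m , x) ∷ l) (1≤m ∷ _) _ m≡0 = <⇒≢ (subst (1 ≤_) m≡0 1≤m) refl

Positive⇒BPartsAvoid-0 : ∀ ps → Positive ps → BPartsAvoid 0 ps
Positive⇒BPartsAvoid-0 ps = All.map (λ 1≤m _ m≡0 → <⇒≢ (subst (1 ≤_) m≡0 1≤m) refl)

PObj-≡ : ∀ {n k i j ℓ} (o o′ : PObj n k i j ℓ) → PObj.lam o ≡ PObj.lam o′ → o ≡ o′
PObj-≡ (pobj l (p₁ , c₁) w₁ x₁ y₁ z₁ b₁) (pobj .l (p₂ , c₂) w₂ x₂ y₂ z₂ b₂) refl
  rewrite All.irrelevant ≤-irrelevant p₁ p₂ | chain-irrelevant c₁ c₂ | ≡-irrelevant w₁ w₂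
        | ≡-irrelevant x₁ x₂ | ≡-irrelevant y₁ y₂ | ≡-irrelevant z₁ z₂
        | All.irrelevant ≤-irrelevant b₁ b₂ = refl

CObj-≡ : ∀ {n k i j ℓ} (o o′ : CObj n k i j ℓ) →
         (CObj.lam o , CObj.mu o) ≡ (CObj.lam o′ , CObj.mu o′) → o ≡ o′
CObj-≡ (cobj l μ (p₁ , c₁) (q₁ , r₁) w₁ x₁ y₁ z₁ b₁ e₁)
       (cobj .l .μ (p₂ , c₂) (q₂ , r₂) w₂ x₂ y₂ z₂ b₂ e₂) refl
  rewrite All.irrelevant ≤-irrelevant p₁ p₂ | chain-irrelevant c₁ c₂ | All.irrelevant ≤-irrelevant q₁ q₂
        | nonIncr-irrelevant r₁ r₂ | ≡-irrelevant w₁ w₂ | ≡-irrelevant x₁ x₂ | ≡-irrelevant y₁ y₂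
        | ≡-irrelevant z₁ z₂ | All.irrelevant ≤-irrelevant b₁ b₂ | All.irrelevant ≤-irrelevant e₁ e₂ = refl

module _ {n k i j ℓ : ℕ} where

  toPObj : CObj n k i j ℓ → PObj n k i j ℓ
  toPObj (cobj l μ (posλ , chλ) (posμ , niμ) wt nA nC nD ≤kλ ≤kμ) =
    pobj (merge 0 l μ)
      (All-merge (1 ≤_) 0 l μ posλ posμ , merge-chain 0 l μ chλ niμ posμ (DHeadGap-0 l))
      (trans (weight-merge 0 l μ) wt) (trans (count-merge-a 0 l μ) nA)
      (trans (count-merge-bc 0 l μ) nC) (trans (count-merge-d 0 l μ) nD)
      (All-merge (_≤ k) 0 l μ ≤kλ ≤kμ)

  toCObj : PObj n k i j ℓ → CObj n k i j ℓ
  toCObj (pobj ps (pos , ch) wt nA nBC nD ≤k) =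
    cobj l μ (All-splitλ (λ q → 1 ≤ proj₁ q) 0 ps pos , split-λ-chain 0 ps ch)
      (All-splitμ (1 ≤_) 0 ps pos , split-μ-nonIncr 0 ps ch)
      (trans (sym (weight-merge 0 l μ)) (trans (cong weight merge∘split) wt))
      (trans (sym (count-merge-a 0 l μ)) (trans (cong (countCol isA-P) merge∘split) nA))
      (trans (sym (count-merge-bc 0 l μ)) (trans (cong (countCol isBC-P) merge∘split) nBC))
      (trans (sym (count-merge-d 0 l μ)) (trans (cong (countCol isD-P) merge∘split) nD))
      (All-splitλ (λ q → proj₁ q ≤ k) 0 ps ≤k) (All-splitμ (_≤ k) 0 ps ≤k)
    where
    l : List (ℕ × ColC)
    l = proj₁ (split 0 ps)
    μ : List ℕ
    μ = proj₂ (split 0 ps)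
    merge∘split : merge 0 l μ ≡ ps
    merge∘split = merge-split 0 ps ch (Positive⇒BPartsAvoid-0 ps pos)

  toPObj∘toCObj : ∀ o → toPObj (toCObj o) ≡ o
  toPObj∘toCObj o@(pobj ps (pos , ch) _ _ _ _ _) =
    PObj-≡ (toPObj (toCObj o)) o (merge-split 0 ps ch (Positive⇒BPartsAvoid-0 ps pos))

  toCObj∘toPObj : ∀ o → toCObj (toPObj o) ≡ o
  toCObj∘toPObj o@(cobj l μ (posλ , chλ) (_ , niμ) _ _ _ _ _ _) =
    CObj-≡ (toCObj (toPObj o)) o (split-merge 0 l μ chλ niμ (Positive⇒CHeadAvoids-0 l posλ))

theorem1p10 : (n k i j ℓ : ℕ) → 1 ≤ n → 1 ≤ k →
    CObj n k i j ℓ ↔ PObj n k i j ℓ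
theorem1p10 n k i j ℓ _ _ = mk↔ₛ′ toPObj toCObj toPObj∘toCObj toCObj∘toPObj
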